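{- Let $m$ and $k$ be odd integers with $k\ge 3$ and $m\ge 2k+3$. Then $\mathrm{msum}(mk,k)\ge 2$.
   Context: $S_n$ denotes the set of permutations $\pi=(\pi_1,\ldots,\pi_n)$ of $1,\ldots,n$, with indices taken cyclically: $\pi_{n+i}=\pi_i$. For $\pi\in S_n$ and $1\le k<n$ let $s_i=\sum_{j=0}^{k-1}\pi_{i+j}$ for $i=1,\ldots,n$. Define $\mathrm{msum}(\pi,k)=\max\{s_i: 1\le i\le n\}-\frac{k(n+1)}{2}$ and $\mathrm{msum}(n,k)=\min\{\mathrm{msum}(\pi,k):\pi\in S_n\}$. -}

module Defs where

open import Data.Nat using (ℕ; zero; suc; _+_; _*_; _⊔_)
open import Data.Nat.DivMod using (_mod_)
open import Data.Fin using (Fin; toℕ)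
open import Data.Fin.Permutation using (Permutation′; _⟨$⟩ʳ_)
open import Data.List using (List; map; foldr; upTo; allFin)
open import Data.Nat.ListAction using (sum)
open import Data.Integer using (+_)
open import Data.Rational using (ℚ; _/_; _-_)
open import Data.Product using (∃)
open import Relation.Binary.PropositionalEquality using (_≡_)

Odd : ℕ → Set
Odd m = ∃ λ j → m ≡ 1 + 2 * j

-- The permutation π ∈ S_n viewed as a map on positions 0..n-1 with values
-- 1..n (i.e. π_{i+1} = value(i)), with cyclic indexing: position p is taken mod n.
-- Window sum s_i = Σ_{j=0}^{k-1} π_{i+j}, for positions i = 0 .. n-1
-- (0-based positions, corresponding to the paper's i = 1 .. n).
windowSum : ∀ {n} → Permutation′ n → ℕ → Fin n → ℕ
windowSum {zero}  π k ()
windowSum {suc n} π k i =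
  sum (map (λ j → suc (toℕ (π ⟨$⟩ʳ ((toℕ i + j) mod (suc n))))) (upTo k))

-- max { s_i : 1 ≤ i ≤ n }  (all values are ≥ 0 and the list is nonempty for n ≥ 1)
maxWindowSum : ∀ {n} → Permutation′ n → ℕ → ℕ
maxWindowSum {n} π k = foldr _⊔_ 0 (map (windowSum π k) (allFin n))

msumπ : ∀ {n} → Permutation′ n → ℕ → ℚ
msumπ {n} π k = ((+ maxWindowSum π k) / 1) - ((+ (k * (n + 1))) / 2)

module Submission where

-- Suppose every window sum s_i is at most A + 1 and put t_i = s_i - A ≤ 1.
-- Then Σ t ≥ 0 and the steps t_{i+1} - t_i = π_{i+k} - π_i never vanish.
--  * jump-bound: the variation Σ |t_{i+1} - t_i| plus twice the number E of
--    low steps (neither end equal to 1) is at most 2 n;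
--  * turn-cover: away from low steps t alternates between 1 and values < 1,
--    so for odd k the steps at i and i + k go in opposite directions unless
--    one of the k + 1 steps between them is low: n ≤ T + (k + 1) E;
--  * variation-bound: the residues mod k split π into k cycles of m distinct
--    values, and a cycle of m distinct values has variation ≥ 2 (m - 2) plus
--    its turns, giving Σ |t_{i+1} - t_i| ≥ 2 k (m - 2) + T.
-- counting-bound combines the three into m ≤ 2 k + 2, a contradiction.

open import Defs
open import Data.Nat using (ℕ; _+_; _*_; _≤_)
open import Data.Fin.Permutation using (Permutation′)
open import Data.Integer using (+_)
open import Data.Rational using (ℚ; _/_)
open import Data.Rational using () renaming (_≤_ to _≤ℚ_)

open import Data.Nat using (zero; suc; _<_; _∸_; _⊔_; _%_; z≤n; s≤s; s≤s⁻¹; _<?_; _≤?_; <-cmp; >-nonZero)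
import Data.Nat.Properties as ℕP
import Data.Nat.Tactic.RingSolver as ℕS
open import Data.Nat.DivMod using (_mod_; m≡m%n+[m/n]*n; [m+kn]%n≡m%n; [m+n]%n≡m%n; m<n⇒m%n≡m) renaming (_/_ to _div_)
open import Data.Nat.Divisibility using (divides; ∣m+n∣m⇒∣n; n∣m*n; ∣⇒≤)
open import Data.Nat.ListAction using (sum)
open import Data.Integer as Z using (ℤ; +[1+_]; -[1+_]; 0ℤ; 1ℤ; -1ℤ; ∣_∣)
  renaming (_+_ to _+ᶻ_; _*_ to _*ᶻ_; _-_ to _-ᶻ_; -_ to -ᶻ_; _≤_ to _≤ᶻ_; _<_ to _<ᶻ_)
import Data.Integer.Properties as ℤP
open import Data.Integer.Tactic.RingSolver using (solve-∀)
open import Data.Rational using (toℚᵘ) renaming (_-_ to _-ℚ_; -_ to -ℚ_)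
import Data.Rational.Properties as ℚP
open import Data.Rational.Unnormalised as ℚᵘ using (mkℚᵘ; *≤*)
import Data.Rational.Unnormalised.Properties as ℚᵘP
open import Data.Bool using (Bool; true; false; _xor_; _∨_; _∧_; not)
open import Data.Bool.Properties using (xor-comm; ∨-zeroʳ; not-involutive)
open import Data.Fin as Fin using (Fin; toℕ; fromℕ<)
import Data.Fin.Properties as FinP
open import Data.Fin.Permutation using (_⟨$⟩ʳ_; _⟨$⟩ˡ_; inverseˡ)
open import Data.List using (applyUpTo; tabulate; foldr)
import Data.List.Properties as ListP
import Algebra.Properties.CommutativeMonoid.Sum as MonoidSum
open import Data.Product using (∃; _,_; _×_; proj₁; proj₂)
open import Data.Sum using (_⊎_; inj₁; inj₂)
open import Data.Empty using (⊥; ⊥-elim)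
open import Function using (_∘_)
open import Relation.Nullary using (does; yes; no)
open import Relation.Nullary.Decidable using (dec-true; dec-false)
open import Relation.Binary using (Tri; tri<; tri≈; tri>)
open import Relation.Binary.PropositionalEquality

Periodic : {A : Set} → ℕ → (ℕ → A) → Set
Periodic n f = ∀ j → f (j + n) ≡ f j

InjectiveOn : ℕ → (ℕ → ℤ) → Set
InjectiveOn n c = ∀ i j → i < n → j < n → c i ≡ c j → i ≡ j

∑ : ℕ → (ℕ → ℤ) → ℤ
∑ zero    f = 0ℤ
∑ (suc L) f = ∑ L f +ᶻ f L

∑-cong< : ∀ L {f g : ℕ → ℤ} → (∀ j → j < L → f j ≡ g j) → ∑ L f ≡ ∑ L g
∑-cong< zero    f≡g = refl
∑-cong< (suc L) f≡g = cong₂ _+ᶻ_ (∑-cong< L (λ j j<L → f≡g j (ℕP.m<n⇒m<1+n j<L))) (f≡g L ℕP.≤-refl)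

∑-cong : ∀ L {f g : ℕ → ℤ} → (∀ j → f j ≡ g j) → ∑ L f ≡ ∑ L g
∑-cong L f≡g = ∑-cong< L (λ j _ → f≡g j)

∑-mono : ∀ L {f g : ℕ → ℤ} → (∀ j → j < L → f j ≤ᶻ g j) → ∑ L f ≤ᶻ ∑ L g
∑-mono zero    f≤g = ℤP.≤-refl
∑-mono (suc L) f≤g = ℤP.+-mono-≤ (∑-mono L (λ j j<L → f≤g j (ℕP.m<n⇒m<1+n j<L))) (f≤g L ℕP.≤-refl)

∑-zero : ∀ L → ∑ L (λ _ → 0ℤ) ≡ 0ℤ
∑-zero zero    = refl
∑-zero (suc L) = cong (_+ᶻ 0ℤ) (∑-zero L)

∑-nonneg : ∀ L {f : ℕ → ℤ} → (∀ j → j < L → 0ℤ ≤ᶻ f j) → 0ℤ ≤ᶻ ∑ L f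
∑-nonneg L {f} f≥0 = subst (_≤ᶻ ∑ L f) (∑-zero L) (∑-mono L f≥0)

∑-+ : ∀ L (f g : ℕ → ℤ) → ∑ L (λ j → f j +ᶻ g j) ≡ ∑ L f +ᶻ ∑ L g
∑-+ zero    f g = refl
∑-+ (suc L) f g = trans (cong (_+ᶻ (f L +ᶻ g L)) (∑-+ L f g)) (interchange (∑ L f) (∑ L g) (f L) (g L))
  where
  interchange : ∀ a b c d → a +ᶻ b +ᶻ (c +ᶻ d) ≡ a +ᶻ c +ᶻ (b +ᶻ d)
  interchange = solve-∀

∑-scale : ∀ L c (f : ℕ → ℤ) → ∑ L (λ j → c *ᶻ f j) ≡ c *ᶻ ∑ L f
∑-scale zero    c f = sym (ℤP.*-zeroʳ c)
∑-scale (suc L) c f = trans (cong (_+ᶻ c *ᶻ f L) (∑-scale L c f)) (sym (ℤP.*-distribˡ-+ c (∑ L f) (f L)))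

∑-neg : ∀ L (f : ℕ → ℤ) → ∑ L (λ j → -ᶻ f j) ≡ -ᶻ ∑ L f
∑-neg L f = trans (∑-cong L (λ j → sym (ℤP.-1*i≡-i (f j)))) (trans (∑-scale L -1ℤ f) (ℤP.-1*i≡-i (∑ L f)))

∑-const : ∀ L c → ∑ L (λ _ → c) ≡ + L *ᶻ c
∑-const zero    c = sym (ℤP.*-zeroˡ c)
∑-const (suc L) c = trans (cong (_+ᶻ c) (∑-const L c)) (distrib (+ L) c)
  where
  distrib : ∀ a c → a *ᶻ c +ᶻ c ≡ (1ℤ +ᶻ a) *ᶻ c
  distrib = solve-∀

∑-unroll : ∀ L (f : ℕ → ℤ) → ∑ (suc L) f ≡ f 0 +ᶻ ∑ L (λ j → f (suc j))
∑-unroll zero    f = ℤP.+-comm 0ℤ (f 0)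
∑-unroll (suc L) f = trans (cong (_+ᶻ f (suc L)) (∑-unroll L f)) (ℤP.+-assoc (f 0) _ (f (suc L)))

∑-split : ∀ a b (f : ℕ → ℤ) → ∑ (a + b) f ≡ ∑ a f +ᶻ ∑ b (λ j → f (a + j))
∑-split a zero    f = trans (cong (λ x → ∑ x f) (ℕP.+-identityʳ a)) (sym (ℤP.+-identityʳ (∑ a f)))
∑-split a (suc b) f = trans (cong (λ x → ∑ x f) (ℕP.+-suc a b))
                        (trans (cong (_+ᶻ f (a + b)) (∑-split a b f)) (ℤP.+-assoc (∑ a f) _ _))

∑-swap : ∀ a b (f : ℕ → ℕ → ℤ) → ∑ a (λ i → ∑ b (λ j → f i j)) ≡ ∑ b (λ j → ∑ a (λ i → f i j))
∑-swap zero    b f = sym (∑-zero b)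
∑-swap (suc a) b f = trans (cong (_+ᶻ ∑ b (f a)) (∑-swap a b f)) (sym (∑-+ b (λ j → ∑ a (λ i → f i j)) (f a)))

∑-telescope : ∀ L (g : ℕ → ℤ) → ∑ L (λ j → g (suc j) -ᶻ g j) ≡ g L -ᶻ g 0
∑-telescope zero    g = sym (ℤP.+-inverseʳ (g 0))
∑-telescope (suc L) g = trans (cong (_+ᶻ (g (suc L) -ᶻ g L)) (∑-telescope L g)) (collapse (g L) (g 0) (g (suc L)))
  where
  collapse : ∀ a b c → a -ᶻ b +ᶻ (c -ᶻ a) ≡ c -ᶻ b
  collapse = solve-∀

∑-shift : ∀ L (f : ℕ → ℤ) → f L ≡ f 0 → ∑ L (λ j → f (suc j)) ≡ ∑ L f
∑-shift zero    f _      = refl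
∑-shift (suc L) f fL≡f0 = begin
    ∑ L (λ j → f (suc j)) +ᶻ f (suc L)  ≡⟨ cong (∑ L (λ j → f (suc j)) +ᶻ_) fL≡f0 ⟩
    ∑ L (λ j → f (suc j)) +ᶻ f 0        ≡⟨ ℤP.+-comm _ (f 0) ⟩
    f 0 +ᶻ ∑ L (λ j → f (suc j))        ≡⟨ sym (∑-unroll L f) ⟩
    ∑ (suc L) f                         ∎
  where open ≡-Reasoning

∑-rotate : ∀ n (f : ℕ → ℤ) → Periodic n f → ∀ a → ∑ n (λ j → f (a + j)) ≡ ∑ n f
∑-rotate n f per zero    = refl
∑-rotate n f per (suc a) = begin
    ∑ n (λ j → f (suc a + j))  ≡⟨ ∑-cong n (λ j → cong f (sym (ℕP.+-suc a j))) ⟩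
    ∑ n (λ j → f (a + suc j))  ≡⟨ ∑-shift n (λ j → f (a + j)) (trans (per a) (cong f (sym (ℕP.+-identityʳ a)))) ⟩
    ∑ n (λ j → f (a + j))      ≡⟨ ∑-rotate n f per a ⟩
    ∑ n f                      ∎
  where open ≡-Reasoning

∑-blocks : ∀ m k (f : ℕ → ℤ) → ∑ (m * k) f ≡ ∑ k (λ r → ∑ m (λ j → f (r + j * k)))
∑-blocks zero    k f = sym (∑-zero k)
∑-blocks (suc m) k f = begin
    ∑ (k + m * k) f
  ≡⟨ cong (λ x → ∑ x f) (ℕP.+-comm k (m * k)) ⟩
    ∑ (m * k + k) f
  ≡⟨ ∑-split (m * k) k f ⟩
    ∑ (m * k) f +ᶻ ∑ k (λ r → f (m * k + r))
  ≡⟨ cong₂ _+ᶻ_ (∑-blocks m k f) (∑-cong k (λ r → cong f (ℕP.+-comm (m * k) r))) ⟩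
    ∑ k (λ r → ∑ m (λ j → f (r + j * k))) +ᶻ ∑ k (λ r → f (r + m * k))
  ≡⟨ sym (∑-+ k _ _) ⟩
    ∑ k (λ r → ∑ (suc m) (λ j → f (r + j * k)))
  ∎
  where open ≡-Reasoning

≤-by-difference : ∀ a b e → b -ᶻ a ≡ e → 0ℤ ≤ᶻ e → a ≤ᶻ b
≤-by-difference a b e b-a≡e 0≤e = ℤP.0≤i-j⇒j≤i (subst (0ℤ ≤ᶻ_) (sym b-a≡e) 0≤e)

ind : Bool → ℤ
ind true  = 1ℤ
ind false = 0ℤ

sgn : Bool → ℤ
sgn true  = 1ℤ
sgn false = -1ℤ

ind-nonneg : ∀ b → 0ℤ ≤ᶻ ind b
ind-nonneg true  = Z.+≤+ z≤n
ind-nonneg false = Z.+≤+ z≤n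

xor-triangle : ∀ x y z → ind (x xor z) ≤ᶻ ind (x xor y) +ᶻ ind (y xor z)
xor-triangle false false false = ℤP.≤-refl
xor-triangle false false true  = ℤP.≤-refl
xor-triangle false true  false = Z.+≤+ z≤n
xor-triangle false true  true  = ℤP.≤-refl
xor-triangle true  false false = ℤP.≤-refl
xor-triangle true  false true  = Z.+≤+ z≤n
xor-triangle true  true  false = ℤP.≤-refl
xor-triangle true  true  true  = ℤP.≤-refl

up : ℤ → Bool
up d = does (0ℤ Z.<? d)

abs : ℤ → ℤ
abs d = + ∣ d ∣

abs-≤ : ∀ {d e} → d ≤ᶻ e → -ᶻ d ≤ᶻ e → abs d ≤ᶻ e
abs-≤ {+ _}       d≤e  _    = d≤e
abs-≤ { -[1+ _ ]} _    -d≤e = -d≤e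

-- Weighting a nonzero step d by a guessed direction s: sgn s · d falls short of
-- |d| by 2 |d| ≥ 2 when the guess is wrong, leaving room for a penalty of 2.
signed-step : ∀ d s → d ≢ 0ℤ → sgn s *ᶻ d +ᶻ + 2 *ᶻ ind (up d xor s) ≤ᶻ abs d
signed-step (+ zero) s     d≢0 = ⊥-elim (d≢0 refl)
signed-step +[1+ n ] true  _   = ℤP.≤-reflexive (sym (identity (+ n)))
  where
  identity : ∀ x → 1ℤ +ᶻ x ≡ 1ℤ *ᶻ (1ℤ +ᶻ x) +ᶻ + 2 *ᶻ 0ℤ
  identity = solve-∀
signed-step +[1+ n ] false _   = ≤-by-difference _ _ (+ n +ᶻ + n) (difference (+ n)) (Z.+≤+ z≤n)
  where
  difference : ∀ x → (1ℤ +ᶻ x) -ᶻ (-1ℤ *ᶻ (1ℤ +ᶻ x) +ᶻ + 2 *ᶻ 1ℤ) ≡ x +ᶻ x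
  difference = solve-∀
signed-step -[1+ n ] true  _   = ≤-by-difference _ _ (+ n +ᶻ + n) (difference (+ n)) (Z.+≤+ z≤n)
  where
  difference : ∀ x → (1ℤ +ᶻ x) -ᶻ (1ℤ *ᶻ (-ᶻ (1ℤ +ᶻ x)) +ᶻ + 2 *ᶻ 1ℤ) ≡ x +ᶻ x
  difference = solve-∀
signed-step -[1+ n ] false _   = ℤP.≤-reflexive (sym (identity (+ n)))
  where
  identity : ∀ x → 1ℤ +ᶻ x ≡ -1ℤ *ᶻ (-ᶻ (1ℤ +ᶻ x)) +ᶻ + 2 *ᶻ 0ℤ
  identity = solve-∀

argmin : ∀ L (c : ℕ → ℤ) → ∃ λ a → a < suc L × (∀ j → j < suc L → c a ≤ᶻ c j)
argmin zero    c = 0 , s≤s z≤n , λ { j (s≤s z≤n) → ℤP.≤-refl }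
argmin (suc L) c with argmin L c
... | a , a<L , a-min with c a ℤP.≤? c (suc L)
...   | yes ca≤cL = a , ℕP.m<n⇒m<1+n a<L , λ j j<L → case j (s≤s⁻¹ j<L)
  where
  case : ∀ j → j ≤ suc L → c a ≤ᶻ c j
  case j j≤L with ℕP.m≤n⇒m<n∨m≡n j≤L
  ... | inj₁ j<L  = a-min j j<L
  ... | inj₂ refl = ca≤cL
...   | no ca≰cL = suc L , ℕP.≤-refl , λ j j<L → case j (s≤s⁻¹ j<L)
  where
  cL≤ca : c (suc L) ≤ᶻ c a
  cL≤ca = ℤP.<⇒≤ (ℤP.≰⇒> ca≰cL)
  case : ∀ j → j ≤ suc L → c (suc L) ≤ᶻ c j
  case j j≤L with ℕP.m≤n⇒m<n∨m≡n j≤L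
  ... | inj₁ j<L  = ℤP.≤-trans cL≤ca (a-min j j<L)
  ... | inj₂ refl = ℤP.≤-refl

argmax : ∀ L (c : ℕ → ℤ) → ∃ λ b → b < suc L × (∀ j → j < suc L → c j ≤ᶻ c b)
argmax L c with argmin L (λ j → -ᶻ c j)
... | b , b<L , b-min = b , b<L , λ j j<L → ℤP.neg-cancel-≤ (b-min j j<L)

-- Pigeonhole: m distinct integers in [c a, c b] force c b - c a ≥ m - 1, since
-- their offsets from c a are m distinct naturals in [0, c b - c a].
spread : ∀ m (c : ℕ → ℤ) a b → b < m → (∀ j → j < m → c a ≤ᶻ c j) → (∀ j → j < m → c j ≤ᶻ c b) →
         InjectiveOn m c → + m -ᶻ 1ℤ ≤ᶻ c b -ᶻ c a
spread m c a b b<m lo hi inj =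
  subst (+ m -ᶻ 1ℤ ≤ᶻ_) (offset-exact b<m)
    (≤-by-difference _ _ _ (rearrange (+ offset b) (+ m)) (ℤP.i≤j⇒0≤j-i (Z.+≤+ m≤1+D)))
  where
  offset : ℕ → ℕ
  offset j = ∣ c j -ᶻ c a ∣
  offset-exact : ∀ {j} → j < m → + offset j ≡ c j -ᶻ c a
  offset-exact j<m = ℤP.0≤i⇒+∣i∣≡i (ℤP.i≤j⇒0≤j-i (lo _ j<m))
  offset-≤ : ∀ (j : Fin m) → offset (toℕ j) < suc (offset b)
  offset-≤ j = s≤s (ℤP.drop‿+≤+ (subst₂ _≤ᶻ_ (sym (offset-exact (FinP.toℕ<n j))) (sym (offset-exact b<m))
                                   (ℤP.+-monoˡ-≤ (-ᶻ c a) (hi _ (FinP.toℕ<n j)))))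
  embed : Fin m → Fin (suc (offset b))
  embed j = fromℕ< (offset-≤ j)
  embed-injective : ∀ {i j} → embed i ≡ embed j → i ≡ j
  embed-injective {i} {j} eq = FinP.toℕ-injective (inj _ _ (FinP.toℕ<n i) (FinP.toℕ<n j) ci≡cj)
    where
    offsets≡ : + offset (toℕ i) ≡ + offset (toℕ j)
    offsets≡ = cong +_ (trans (sym (FinP.toℕ-fromℕ< (offset-≤ i))) (trans (cong toℕ eq) (FinP.toℕ-fromℕ< (offset-≤ j))))
    differences≡ : c (toℕ i) -ᶻ c a ≡ c (toℕ j) -ᶻ c a
    differences≡ = trans (sym (offset-exact (FinP.toℕ<n i))) (trans offsets≡ (offset-exact (FinP.toℕ<n j)))
    ci≡cj : c (toℕ i) ≡ c (toℕ j)
    ci≡cj = trans (sym (sub-add (c (toℕ i)) (c a))) (trans (cong (_+ᶻ c a) differences≡) (sub-add (c (toℕ j)) (c a)))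
      where
      sub-add : ∀ x z → x -ᶻ z +ᶻ z ≡ x
      sub-add = solve-∀
  m≤1+D : m ≤ suc (offset b)
  m≤1+D = FinP.injective⇒≤ {f = embed} embed-injective
  rearrange : ∀ D M → D -ᶻ (M -ᶻ 1ℤ) ≡ (1ℤ +ᶻ D) -ᶻ M
  rearrange = solve-∀

Δ : (ℕ → ℤ) → ℕ → ℤ
Δ c j = c (suc j) -ᶻ c j

variation : ℕ → (ℕ → ℤ) → ℤ
variation m c = ∑ m (λ j → abs (Δ c j))

turns : ℕ → (ℕ → ℤ) → ℤ
turns m c = ∑ m (λ j → ind (up (Δ c j) xor up (Δ c (suc j))))

changes-of-constant : ∀ L (g : ℕ → Bool) v → (∀ j → j < L → g j ≡ v) →
                      ∑ L (λ j → ind (g j xor g (suc j))) ≤ᶻ 1ℤ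
changes-of-constant zero    g v _      = Z.+≤+ z≤n
changes-of-constant (suc L) g v g≡v = subst (_≤ᶻ 1ℤ) (sym (cong (_+ᶻ last) no-earlier-change)) (last≤1 (g L xor g (suc L)))
  where
  last : ℤ
  last = ind (g L xor g (suc L))
  same : ∀ w → (w xor w) ≡ false
  same true  = refl
  same false = refl
  no-earlier-change : ∑ L (λ j → ind (g j xor g (suc j))) ≡ 0ℤ
  no-earlier-change = trans (∑-cong< L (λ j j<L → cong ind (trans (cong₂ _xor_ (g≡v j (ℕP.m<n⇒m<1+n j<L)) (g≡v (suc j) (s≤s j<L))) (same v))))
                            (∑-zero L)
  last≤1 : ∀ b → 0ℤ +ᶻ ind b ≤ᶻ 1ℤ
  last≤1 true  = ℤP.≤-refl
  last≤1 false = Z.+≤+ z≤n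

turn-step : ∀ a a' s s' → ind (a xor a') ≤ᶻ ind (a xor s) +ᶻ ind (a' xor s') +ᶻ ind (s xor s')
turn-step a a' s s' = begin
    ind (a xor a')
  ≤⟨ xor-triangle a s a' ⟩
    ind (a xor s) +ᶻ ind (s xor a')
  ≤⟨ ℤP.+-monoʳ-≤ (ind (a xor s)) (xor-triangle s s' a') ⟩
    ind (a xor s) +ᶻ (ind (s xor s') +ᶻ ind (s' xor a'))
  ≡⟨ cong (λ x → ind (a xor s) +ᶻ (ind (s xor s') +ᶻ ind x)) (xor-comm s' a') ⟩
    ind (a xor s) +ᶻ (ind (s xor s') +ᶻ ind (a' xor s'))
  ≡⟨ reorder (ind (a xor s)) (ind (s xor s')) (ind (a' xor s')) ⟩
    ind (a xor s) +ᶻ ind (a' xor s') +ᶻ ind (s xor s')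
  ∎
  where
  open ℤP.≤-Reasoning
  reorder : ∀ x y z → x +ᶻ (y +ᶻ z) ≡ x +ᶻ z +ᶻ y
  reorder = solve-∀

-- Going up from c 0 to c b and down again: for 0 < b < m the variation is at
-- least 2 (c b - c 0) plus the turns, minus 2.  We guess "up" on [0, b) and
-- "down" on [b, m); each wrong guess costs 2 (signed-step) and each turn needs
-- a wrong guess or one of the two changes of guess (turn-step).
module Climb (m b : ℕ) (c : ℕ → ℤ) (0<b : 0 < b) (b<m : b < m)
             (per : Periodic m c) (nonflat : ∀ j → Δ c j ≢ 0ℤ) where

  guess : ℕ → Bool
  guess j = does (j <? b) ∨ does (m ≤? j)

  wrong : ℕ → ℤ
  wrong j = ind (up (Δ c j) xor guess j)

  W : ℤ
  W = ∑ m wrong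

  guess-up : ∀ j → j < b → guess j ≡ true
  guess-up j j<b rewrite dec-true (j <? b) j<b = refl

  guess-down : ∀ j → b ≤ j → j < m → guess j ≡ false
  guess-down j b≤j j<m rewrite dec-false (j <? b) (ℕP.≤⇒≯ b≤j) | dec-false (m ≤? j) (ℕP.<⇒≱ j<m) = refl

  r : ℕ
  r = m ∸ b

  b+r≡m : b + r ≡ m
  b+r≡m = ℕP.m+[n∸m]≡n (ℕP.<⇒≤ b<m)

  b+i<m : ∀ i → i < r → b + i < m
  b+i<m i i<r = subst (b + i <_) b+r≡m (ℕP.+-monoʳ-< b i<r)

  -- Summing the steps with the guessed signs telescopes twice to c b - c 0.
  signed-sum : ∑ m (λ j → sgn (guess j) *ᶻ Δ c j) ≡ + 2 *ᶻ (c b -ᶻ c 0)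
  signed-sum = begin
      ∑ m (λ j → sgn (guess j) *ᶻ Δ c j)
    ≡⟨ cong (λ x → ∑ x (λ j → sgn (guess j) *ᶻ Δ c j)) (sym b+r≡m) ⟩
      ∑ (b + r) (λ j → sgn (guess j) *ᶻ Δ c j)
    ≡⟨ ∑-split b r _ ⟩
      ∑ b (λ j → sgn (guess j) *ᶻ Δ c j) +ᶻ ∑ r (λ i → sgn (guess (b + i)) *ᶻ Δ c (b + i))
    ≡⟨ cong₂ _+ᶻ_ ascent descent ⟩
      (c b -ᶻ c 0) +ᶻ -ᶻ (c 0 -ᶻ c b)
    ≡⟨ double (c b) (c 0) ⟩
      + 2 *ᶻ (c b -ᶻ c 0)
    ∎
    where
    open ≡-Reasoning
    double : ∀ x y → (x -ᶻ y) +ᶻ -ᶻ (y -ᶻ x) ≡ + 2 *ᶻ (x -ᶻ y)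
    double = solve-∀
    ascent : ∑ b (λ j → sgn (guess j) *ᶻ Δ c j) ≡ c b -ᶻ c 0
    ascent = trans (∑-cong< b (λ j j<b → trans (cong (λ s → sgn s *ᶻ Δ c j) (guess-up j j<b)) (ℤP.*-identityˡ (Δ c j))))
                   (∑-telescope b c)
    descent : ∑ r (λ i → sgn (guess (b + i)) *ᶻ Δ c (b + i)) ≡ -ᶻ (c 0 -ᶻ c b)
    descent = begin
        ∑ r (λ i → sgn (guess (b + i)) *ᶻ Δ c (b + i))
      ≡⟨ ∑-cong< r (λ i i<r → trans (cong (λ s → sgn s *ᶻ Δ c (b + i)) (guess-down (b + i) (ℕP.m≤m+n b i) (b+i<m i i<r)))
                                    (trans (ℤP.-1*i≡-i _) (cong (λ x → -ᶻ (c x -ᶻ c (b + i))) (sym (ℕP.+-suc b i))))) ⟩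
        ∑ r (λ i → -ᶻ (c (b + suc i) -ᶻ c (b + i)))
      ≡⟨ trans (∑-neg r _) (cong -ᶻ_ (∑-telescope r (λ i → c (b + i)))) ⟩
        -ᶻ (c (b + r) -ᶻ c (b + 0))
      ≡⟨ cong₂ (λ x y → -ᶻ (c x -ᶻ c y)) b+r≡m (ℕP.+-identityʳ b) ⟩
        -ᶻ (c m -ᶻ c b)
      ≡⟨ cong (λ x → -ᶻ (x -ᶻ c b)) (per 0) ⟩
        -ᶻ (c 0 -ᶻ c b)
      ∎

  climb-cost : + 2 *ᶻ (c b -ᶻ c 0) +ᶻ + 2 *ᶻ W ≤ᶻ variation m c
  climb-cost = subst (_≤ᶻ variation m c) split-sum
                 (∑-mono m (λ j _ → signed-step (Δ c j) (guess j) (nonflat j)))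
    where
    split-sum : ∑ m (λ j → sgn (guess j) *ᶻ Δ c j +ᶻ + 2 *ᶻ wrong j) ≡ + 2 *ᶻ (c b -ᶻ c 0) +ᶻ + 2 *ᶻ W
    split-sum = trans (∑-+ m _ _) (cong₂ _+ᶻ_ signed-sum (∑-scale m (+ 2) wrong))

  -- The guess changes only at b and at m.
  guess-changes : ∑ m (λ j → ind (guess j xor guess (suc j))) ≤ᶻ + 2
  guess-changes = subst (_≤ᶻ + 2) (sym split-at-b)
    (ℤP.+-mono-≤ (changes-of-constant b guess true guess-up)
                 (changes-of-constant r (λ i → guess (b + i)) false
                    (λ i i<r → guess-down (b + i) (ℕP.m≤m+n b i) (b+i<m i i<r))))
    where
    split-at-b : ∑ m (λ j → ind (guess j xor guess (suc j)))
               ≡ ∑ b (λ j → ind (guess j xor guess (suc j))) +ᶻ ∑ r (λ i → ind (guess (b + i) xor guess (b + suc i)))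
    split-at-b = trans (cong (λ x → ∑ x (λ j → ind (guess j xor guess (suc j)))) (sym b+r≡m))
                   (trans (∑-split b r _) (cong (∑ b (λ j → ind (guess j xor guess (suc j))) +ᶻ_)
                     (∑-cong r (λ i → cong (λ x → ind (guess (b + i) xor guess x)) (sym (ℕP.+-suc b i))))))

  turn-cost : turns m c ≤ᶻ + 2 *ᶻ W +ᶻ + 2
  turn-cost = begin
      turns m c
    ≤⟨ ∑-mono m (λ j _ → turn-step (up (Δ c j)) (up (Δ c (suc j))) (guess j) (guess (suc j))) ⟩
      ∑ m (λ j → wrong j +ᶻ wrong (suc j) +ᶻ ind (guess j xor guess (suc j)))
    ≡⟨ trans (∑-+ m _ _) (cong (_+ᶻ ∑ m (λ j → ind (guess j xor guess (suc j)))) (∑-+ m wrong (λ j → wrong (suc j)))) ⟩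
      W +ᶻ ∑ m (λ j → wrong (suc j)) +ᶻ ∑ m (λ j → ind (guess j xor guess (suc j)))
    ≡⟨ cong (λ x → W +ᶻ x +ᶻ ∑ m (λ j → ind (guess j xor guess (suc j)))) (∑-shift m wrong wrong-m≡wrong-0) ⟩
      W +ᶻ W +ᶻ ∑ m (λ j → ind (guess j xor guess (suc j)))
    ≤⟨ ℤP.+-monoʳ-≤ (W +ᶻ W) guess-changes ⟩
      W +ᶻ W +ᶻ + 2
    ≡⟨ cong (_+ᶻ + 2) (twice W) ⟩
      + 2 *ᶻ W +ᶻ + 2
    ∎
    where
    open ℤP.≤-Reasoning
    twice : ∀ x → x +ᶻ x ≡ + 2 *ᶻ x
    twice = solve-∀
    guess-m : guess m ≡ true
    guess-m rewrite dec-true (m ≤? m) ℕP.≤-refl = ∨-zeroʳ (does (m <? b))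
    wrong-m≡wrong-0 : wrong m ≡ wrong 0
    wrong-m≡wrong-0 = cong₂ (λ d s → ind (up d xor s)) (cong₂ _-ᶻ_ (per 1) (per 0))
                        (trans guess-m (sym (guess-up 0 0<b)))

  climb-bound : + 2 *ᶻ (c b -ᶻ c 0) +ᶻ turns m c -ᶻ + 2 ≤ᶻ variation m c
  climb-bound = ℤP.≤-trans (ℤP.≤-trans (ℤP.+-monoˡ-≤ (-ᶻ + 2) (ℤP.+-monoʳ-≤ (+ 2 *ᶻ (c b -ᶻ c 0)) turn-cost))
                                       (ℤP.≤-reflexive (cancel-2 (+ 2 *ᶻ (c b -ᶻ c 0)) (+ 2 *ᶻ W))))
                           climb-cost
    where
    cancel-2 : ∀ x y → x +ᶻ (y +ᶻ + 2) -ᶻ + 2 ≡ x +ᶻ y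
    cancel-2 = solve-∀

rotate : ℕ → (ℕ → ℤ) → ℕ → ℤ
rotate a c j = c (a + j)

Δ-rotate : ∀ a c j → Δ (rotate a c) j ≡ Δ c (a + j)
Δ-rotate a c j = cong (λ x → c x -ᶻ c (a + j)) (ℕP.+-suc a j)

Δ-periodic : ∀ {m c} → Periodic m c → Periodic m (Δ c)
Δ-periodic per j = cong₂ _-ᶻ_ (per (suc j)) (per j)

variation-rotate : ∀ m c a → Periodic m c → variation m (rotate a c) ≡ variation m c
variation-rotate m c a per =
  trans (∑-cong m (λ j → cong abs (Δ-rotate a c j)))
        (∑-rotate m (λ j → abs (Δ c j)) (λ j → cong abs (Δ-periodic per j)) a)

turns-rotate : ∀ m c a → Periodic m c → turns m (rotate a c) ≡ turns m c
turns-rotate m c a per =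
  trans (∑-cong m (λ j → cong₂ (λ d d' → ind (up d xor up d')) (Δ-rotate a c j)
                                (trans (Δ-rotate a c (suc j)) (cong (Δ c) (ℕP.+-suc a j)))))
        (∑-rotate m turn (λ j → cong₂ (λ d d' → ind (up d xor up d')) (Δ-periodic per j) (Δ-periodic per (suc j))) a)
  where
  turn : ℕ → ℤ
  turn j = ind (up (Δ c j) xor up (Δ c (suc j)))

climb-from : ∀ m c → Periodic m c → (∀ j → Δ c j ≢ 0ℤ) → ∀ a b' → 0 < b' → b' < m →
             + 2 *ᶻ (c (a + b') -ᶻ c a) +ᶻ turns m c -ᶻ + 2 ≤ᶻ variation m c
climb-from m c per nonflat a b' 0<b' b'<m =
  subst₂ _≤ᶻ_ (cong (λ x → + 2 *ᶻ (c (a + b') -ᶻ c x) +ᶻ turns m c -ᶻ + 2) (ℕP.+-identityʳ a))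
              (variation-rotate m c a per)
    (subst (λ t → + 2 *ᶻ (c (a + b') -ᶻ c (a + 0)) +ᶻ t -ᶻ + 2 ≤ᶻ variation m (rotate a c))
           (turns-rotate m c a per)
           (Climb.climb-bound m b' (rotate a c) 0<b' b'<m rotated-periodic rotated-nonflat))
  where
  rotated-periodic : Periodic m (rotate a c)
  rotated-periodic j = trans (cong c (sym (ℕP.+-assoc a j m))) (per (a + j))
  rotated-nonflat : ∀ j → Δ (rotate a c) j ≢ 0ℤ
  rotated-nonflat j eq = nonflat (a + j) (trans (sym (Δ-rotate a c j)) eq)

-- Apply the climb bound from a minimum to a maximum, whose gap is ≥ m - 1.
variation-bound : ∀ m c → 2 ≤ m → Periodic m c → (∀ j → Δ c j ≢ 0ℤ) → InjectiveOn m c →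
                  + 2 *ᶻ (+ m -ᶻ + 2) +ᶻ turns m c ≤ᶻ variation m c
variation-bound (suc L) c 2≤m per nonflat inj with argmin L c | argmax L c
... | a , a<m , a-min | b , b<m , b-max = ℤP.≤-trans lower (climb (<-cmp a b))
  where
  m = suc L
  gap : + m -ᶻ 1ℤ ≤ᶻ c b -ᶻ c a
  gap = spread m c a b b<m a-min b-max inj
  lower : + 2 *ᶻ (+ m -ᶻ + 2) +ᶻ turns m c ≤ᶻ + 2 *ᶻ (c b -ᶻ c a) +ᶻ turns m c -ᶻ + 2
  lower = subst (_≤ᶻ + 2 *ᶻ (c b -ᶻ c a) +ᶻ turns m c -ᶻ + 2) (regroup (+ m) (turns m c))
            (ℤP.+-monoˡ-≤ (-ᶻ + 2) (ℤP.+-monoˡ-≤ (turns m c) (ℤP.*-monoˡ-≤-nonNeg (+ 2) gap)))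
    where
    regroup : ∀ x t → + 2 *ᶻ (x -ᶻ 1ℤ) +ᶻ t -ᶻ + 2 ≡ + 2 *ᶻ (x -ᶻ + 2) +ᶻ t
    regroup = solve-∀
  climb : Tri (a < b) (a ≡ b) (b < a) → + 2 *ᶻ (c b -ᶻ c a) +ᶻ turns m c -ᶻ + 2 ≤ᶻ variation m c
  climb (tri< a<b _ _) =
    subst (λ x → + 2 *ᶻ (c x -ᶻ c a) +ᶻ turns m c -ᶻ + 2 ≤ᶻ variation m c) (ℕP.m+[n∸m]≡n (ℕP.<⇒≤ a<b))
      (climb-from m c per nonflat a (b ∸ a) (ℕP.m<n⇒0<n∸m a<b) (ℕP.≤-<-trans (ℕP.m∸n≤m b a) b<m))
  climb (tri≈ _ refl _) = ⊥-elim (ℕP.<⇒≱ 2≤m (s≤s (ℤP.drop‿+≤+ (subst₂ _≤ᶻ_ (pred-m (+ L)) (ℤP.+-inverseʳ (c a)) gap))))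
    where
    pred-m : ∀ x → (1ℤ +ᶻ x) -ᶻ 1ℤ ≡ x
    pred-m = solve-∀
  climb (tri> _ _ b<a) =
    subst (λ x → + 2 *ᶻ (x -ᶻ c a) +ᶻ turns m c -ᶻ + 2 ≤ᶻ variation m c) (trans (cong c a+b'≡b+m) (per b))
      (climb-from m c per nonflat a (b + m ∸ a) (ℕP.m<n⇒0<n∸m (ℕP.<-≤-trans a<m (ℕP.m≤n+m m b)))
         (ℕP.+-cancelˡ-< a _ _ (subst (_< a + m) (sym a+b'≡b+m) (ℕP.+-monoˡ-< m b<a))))
    where
    a+b'≡b+m : a + (b + m ∸ a) ≡ b + m
    a+b'≡b+m = ℕP.m+[n∸m]≡n (ℕP.≤-trans (ℕP.<⇒≤ a<m) (ℕP.m≤n+m m b))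

is-one : ℤ → Bool
is-one x = does (x Z.≟ 1ℤ)

low-step : ℤ → ℤ → Bool
low-step x y = not (is-one x) ∧ not (is-one y)

below-one : ∀ {x} → x ≤ᶻ 1ℤ → x ≢ 1ℤ → x ≤ᶻ 0ℤ
below-one x≤1 x≢1 = ℤP.i<j⇒i≤pred[j] (ℤP.≤∧≢⇒< x≤1 x≢1)

low-room : ∀ x y → x ≤ᶻ 1ℤ → y ≤ᶻ 1ℤ →
           (x ≤ᶻ 1ℤ -ᶻ ind (low-step x y)) × (y ≤ᶻ 1ℤ -ᶻ ind (low-step x y))
low-room x y x≤1 y≤1 with x Z.≟ 1ℤ | y Z.≟ 1ℤ
... | yes _   | _       = x≤1 , y≤1
... | no _    | yes _   = x≤1 , y≤1
... | no x≢1  | no y≢1  = below-one x≤1 x≢1 , below-one y≤1 y≢1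

pair-step : ∀ x y → x ≤ᶻ 1ℤ → y ≤ᶻ 1ℤ → abs (y -ᶻ x) +ᶻ + 2 *ᶻ ind (low-step x y) ≤ᶻ + 2 -ᶻ x -ᶻ y
pair-step x y x≤1 y≤1 with low-room x y x≤1 y≤1
... | x≤1-s , y≤1-s =
  subst (abs (y -ᶻ x) +ᶻ + 2 *ᶻ s ≤ᶻ_) (restore x y s)
    (ℤP.+-monoˡ-≤ (+ 2 *ᶻ s) (abs-≤ {y -ᶻ x} {room-left}
                                (≤-by-difference _ room-left _ (room-above-y x y s) (room y y≤1-s))
                                (≤-by-difference _ room-left _ (room-above-x x y s) (room x x≤1-s))))
  where
  s : ℤ
  s = ind (low-step x y)
  room-left : ℤ
  room-left = + 2 -ᶻ x -ᶻ y -ᶻ + 2 *ᶻ s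
  room : ∀ z → z ≤ᶻ 1ℤ -ᶻ s → 0ℤ ≤ᶻ (1ℤ -ᶻ s -ᶻ z) +ᶻ (1ℤ -ᶻ s -ᶻ z)
  room z z≤ = ℤP.+-mono-≤ (ℤP.i≤j⇒0≤j-i z≤) (ℤP.i≤j⇒0≤j-i z≤)
  room-above-y : ∀ x y s → (+ 2 -ᶻ x -ᶻ y -ᶻ + 2 *ᶻ s) -ᶻ (y -ᶻ x) ≡ (1ℤ -ᶻ s -ᶻ y) +ᶻ (1ℤ -ᶻ s -ᶻ y)
  room-above-y = solve-∀
  room-above-x : ∀ x y s → (+ 2 -ᶻ x -ᶻ y -ᶻ + 2 *ᶻ s) -ᶻ -ᶻ (y -ᶻ x) ≡ (1ℤ -ᶻ s -ᶻ x) +ᶻ (1ℤ -ᶻ s -ᶻ x)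
  room-above-x = solve-∀
  restore : ∀ x y s → + 2 -ᶻ x -ᶻ y -ᶻ + 2 *ᶻ s +ᶻ + 2 *ᶻ s ≡ + 2 -ᶻ x -ᶻ y
  restore = solve-∀

peak-step : ∀ x y → x ≤ᶻ 1ℤ → y ≤ᶻ 1ℤ → x ≢ y → low-step x y ≡ false →
            (up (y -ᶻ x) ≡ is-one y) × (is-one y ≡ not (is-one x))
peak-step x y x≤1 y≤1 x≢y not-low with x Z.≟ 1ℤ | y Z.≟ 1ℤ
... | yes refl | yes refl = ⊥-elim (x≢y refl)
... | yes refl | no _     = dec-false (0ℤ Z.<? y -ᶻ 1ℤ) (ℤP.≤⇒≯ (ℤP.i≤j⇒i-j≤0 y≤1)) , refl
... | no x≢1   | yes refl = dec-true (0ℤ Z.<? 1ℤ -ᶻ x) 0<1-x , refl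
  where
  0<1-x : 0ℤ <ᶻ 1ℤ -ᶻ x
  0<1-x = ℤP.suc[i]≤j⇒i<j (≤-by-difference 1ℤ (1ℤ -ᶻ x) (-ᶻ x) (drop-one x) (ℤP.neg-mono-≤ (below-one x≤1 x≢1)))
    where
    drop-one : ∀ x → (1ℤ -ᶻ x) -ᶻ 1ℤ ≡ -ᶻ x
    drop-one = solve-∀
... | no _     | no _     with not-low
...   | ()

none-or-some : ∀ L (g : ℕ → Bool) → (∀ j → j < L → g j ≡ false) ⊎ (1ℤ ≤ᶻ ∑ L (λ j → ind (g j)))
none-or-some zero    g = inj₁ (λ j ())
none-or-some (suc L) g with none-or-some L g | g L in gL
... | inj₂ some  | b     = inj₂ (subst (_≤ᶻ ∑ L (λ j → ind (g j)) +ᶻ ind b) (ℤP.+-identityʳ 1ℤ) (ℤP.+-mono-≤ some (ind-nonneg b)))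
... | inj₁ _     | true  = inj₂ (subst (_≤ᶻ ∑ L (λ j → ind (g j)) +ᶻ 1ℤ) (ℤP.+-identityˡ 1ℤ)
                                   (ℤP.+-monoˡ-≤ 1ℤ (∑-nonneg L (λ j _ → ind-nonneg (g j)))))
... | inj₁ none  | false = inj₁ (λ j j<1+L → case j (s≤s⁻¹ j<1+L))
  where
  case : ∀ j → j ≤ L → g j ≡ false
  case j j≤L with ℕP.m≤n⇒m<n∨m≡n j≤L
  ... | inj₁ j<L  = none j j<L
  ... | inj₂ refl = gL

module Peaks (n : ℕ) (t : ℕ → ℤ) (per : Periodic n t)
             (t≤1 : ∀ i → t i ≤ᶻ 1ℤ) (nonflat : ∀ i → Δ t i ≢ 0ℤ) where

  peak : ℕ → Bool
  peak i = is-one (t i)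

  low : ℕ → Bool
  low i = low-step (t i) (t (suc i))

  lows : ℤ
  lows = ∑ n (λ i → ind (low i))

  jump-bound : 0ℤ ≤ᶻ ∑ n t → variation n t +ᶻ + 2 *ᶻ lows ≤ᶻ + 2 *ᶻ + n
  jump-bound ∑t≥0 = begin
      variation n t +ᶻ + 2 *ᶻ lows
    ≡⟨ sym (trans (∑-+ n _ _) (cong (variation n t +ᶻ_) (∑-scale n (+ 2) (λ i → ind (low i))))) ⟩
      ∑ n (λ i → abs (Δ t i) +ᶻ + 2 *ᶻ ind (low i))
    ≤⟨ ∑-mono n (λ i _ → pair-step (t i) (t (suc i)) (t≤1 i) (t≤1 (suc i))) ⟩
      ∑ n (λ i → + 2 -ᶻ t i -ᶻ t (suc i))
    ≡⟨ room-sum ⟩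
      + n *ᶻ + 2 -ᶻ ∑ n t -ᶻ ∑ n t
    ≤⟨ ≤-by-difference _ _ _ (surplus (+ n) (∑ n t)) (ℤP.+-mono-≤ ∑t≥0 ∑t≥0) ⟩
      + 2 *ᶻ + n
    ∎
    where
    open ℤP.≤-Reasoning
    surplus : ∀ a b → + 2 *ᶻ a -ᶻ (a *ᶻ + 2 -ᶻ b -ᶻ b) ≡ b +ᶻ b
    surplus = solve-∀
    room-sum : ∑ n (λ i → + 2 -ᶻ t i -ᶻ t (suc i)) ≡ + n *ᶻ + 2 -ᶻ ∑ n t -ᶻ ∑ n t
    room-sum = begin-equality
        ∑ n (λ i → + 2 -ᶻ t i -ᶻ t (suc i))
      ≡⟨ trans (∑-+ n _ _) (cong₂ _+ᶻ_ (∑-+ n _ _) (∑-neg n (λ i → t (suc i)))) ⟩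
        ∑ n (λ _ → + 2) +ᶻ ∑ n (λ i → -ᶻ t i) +ᶻ -ᶻ ∑ n (λ i → t (suc i))
      ≡⟨ cong₂ (λ a b → a +ᶻ b +ᶻ -ᶻ ∑ n (λ i → t (suc i))) (∑-const n (+ 2)) (∑-neg n t) ⟩
        + n *ᶻ + 2 -ᶻ ∑ n t -ᶻ ∑ n (λ i → t (suc i))
      ≡⟨ cong (λ x → + n *ᶻ + 2 -ᶻ ∑ n t -ᶻ x) (∑-shift n t (per 0)) ⟩
        + n *ᶻ + 2 -ᶻ ∑ n t -ᶻ ∑ n t
      ∎

  distinct : ∀ i → t i ≢ t (suc i)
  distinct i ti≡ti+1 = nonflat i (ℤP.i≡j⇒i-j≡0 (sym ti≡ti+1))

  up-to-peak : ∀ i → low i ≡ false → up (Δ t i) ≡ peak (suc i)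
  up-to-peak i not-low = proj₁ (peak-step (t i) (t (suc i)) (t≤1 i) (t≤1 (suc i)) (distinct i) not-low)

  alternate : ∀ i → low i ≡ false → peak (suc i) ≡ not (peak i)
  alternate i not-low = proj₂ (peak-step (t i) (t (suc i)) (t≤1 i) (t≤1 (suc i)) (distinct i) not-low)

  -- Along 2q consecutive steps that are not low, peaks alternate, hence return.
  peaks-return : ∀ i q → (∀ j → j < q + q → low (i + j) ≡ false) → peak (i + (q + q)) ≡ peak i
  peaks-return i zero    _       = cong peak (ℕP.+-identityʳ i)
  peaks-return i (suc q) not-low = begin
      peak (i + (suc q + suc q))
    ≡⟨ cong peak (reindex i q) ⟩
      peak (suc (suc (i + (q + q))))
    ≡⟨ alternate (suc (i + (q + q))) (trans (cong low (sym (ℕP.+-suc i (q + q)))) (not-low (suc (q + q)) last<)) ⟩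
      not (peak (suc (i + (q + q))))
    ≡⟨ cong not (alternate (i + (q + q)) (not-low (q + q) first<)) ⟩
      not (not (peak (i + (q + q))))
    ≡⟨ not-involutive _ ⟩
      peak (i + (q + q))
    ≡⟨ peaks-return i q (λ j j<2q → not-low j (ℕP.<-trans j<2q first<)) ⟩
      peak i
    ∎
    where
    open ≡-Reasoning
    reindex : ∀ i q → i + (suc q + suc q) ≡ suc (suc (i + (q + q)))
    reindex = ℕS.solve-∀
    first< : q + q < suc q + suc q
    first< = s≤s (ℕP.+-monoʳ-≤ q (ℕP.n≤1+n q))
    last< : suc (q + q) < suc q + suc q
    last< = s≤s (ℕP.≤-reflexive (sym (ℕP.+-suc q q)))

  -- For odd k, the steps i and i + k go in different directions unless one
  -- of the k + 1 steps i, ..., i + k is low: the peaks alternate in between.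
  turn-or-low : ∀ k → Odd k → ∀ i →
                1ℤ ≤ᶻ ind (up (Δ t i) xor up (Δ t (i + k))) +ᶻ ∑ (suc k) (λ j → ind (low (i + j)))
  turn-or-low k (h , k≡1+2h) i with none-or-some (suc k) (λ j → low (i + j))
  ... | inj₂ some = subst (_≤ᶻ cover) (ℤP.+-identityˡ 1ℤ) (ℤP.+-mono-≤ (ind-nonneg (up (Δ t i) xor up (Δ t (i + k)))) some)
    where cover = ind (up (Δ t i) xor up (Δ t (i + k))) +ᶻ ∑ (suc k) (λ j → ind (low (i + j)))
  ... | inj₁ none = subst (_≤ᶻ cover) (ℤP.+-identityʳ 1ℤ)
                      (ℤP.+-mono-≤ (ℤP.≤-reflexive (cong ind (sym opposite))) (∑-nonneg (suc k) (λ j _ → ind-nonneg _)))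
    where
    cover = ind (up (Δ t i) xor up (Δ t (i + k))) +ᶻ ∑ (suc k) (λ j → ind (low (i + j)))
    first-not-low : low i ≡ false
    first-not-low = trans (cong low (sym (ℕP.+-identityʳ i))) (none 0 (s≤s z≤n))
    1+k≡2[1+h] : suc k ≡ suc h + suc h
    1+k≡2[1+h] = trans (cong suc k≡1+2h) (double h)
      where
      double : ∀ h → suc (1 + 2 * h) ≡ suc h + suc h
      double = ℕS.solve-∀
    up-first : up (Δ t i) ≡ not (peak i)
    up-first = trans (up-to-peak i first-not-low) (alternate i first-not-low)
    up-last : up (Δ t (i + k)) ≡ peak i
    up-last = trans (up-to-peak (i + k) (none k ℕP.≤-refl))
                (trans (cong peak (trans (sym (ℕP.+-suc i k)) (cong (λ x → i + x) 1+k≡2[1+h])))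
                       (peaks-return i (suc h) (λ j j< → none j (subst (j <_) (sym 1+k≡2[1+h]) j<))))
    opposite : (up (Δ t i) xor up (Δ t (i + k))) ≡ true
    opposite rewrite up-first | up-last = not-xor (peak i)
      where
      not-xor : ∀ b → (not b xor b) ≡ true
      not-xor true  = refl
      not-xor false = refl

  turn-cover : ∀ k → Odd k → + n ≤ᶻ ∑ n (λ i → ind (up (Δ t i) xor up (Δ t (i + k)))) +ᶻ + suc k *ᶻ lows
  turn-cover k k-odd = begin
      + n
    ≡⟨ sym (trans (∑-const n 1ℤ) (ℤP.*-identityʳ (+ n))) ⟩
      ∑ n (λ _ → 1ℤ)
    ≤⟨ ∑-mono n (λ i _ → turn-or-low k k-odd i) ⟩
      ∑ n (λ i → ind (up (Δ t i) xor up (Δ t (i + k))) +ᶻ ∑ (suc k) (λ j → ind (low (i + j))))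
    ≡⟨ trans (∑-+ n _ _) (cong (∑ n (λ i → ind (up (Δ t i) xor up (Δ t (i + k)))) +ᶻ_) low-count) ⟩
      ∑ n (λ i → ind (up (Δ t i) xor up (Δ t (i + k)))) +ᶻ + suc k *ᶻ lows
    ∎
    where
    open ℤP.≤-Reasoning
    low-periodic : Periodic n (λ i → ind (low i))
    low-periodic i = cong ind (cong₂ low-step (per i) (per (suc i)))
    low-count : ∑ n (λ i → ∑ (suc k) (λ j → ind (low (i + j)))) ≡ + suc k *ᶻ lows
    low-count = trans (∑-swap n (suc k) (λ i j → ind (low (i + j))))
                  (trans (∑-cong (suc k) (λ j → trans (∑-cong n (λ i → cong (λ x → ind (low x)) (ℕP.+-comm i j)))
                                                      (∑-rotate n (λ i → ind (low i)) low-periodic j)))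
                         (∑-const (suc k) lows))

nonneg-* : ∀ a {b} → 0ℤ ≤ᶻ a → 0ℤ ≤ᶻ b → 0ℤ ≤ᶻ a *ᶻ b
nonneg-* (+ a) {+ b} _ _ = subst (0ℤ ≤ᶻ_) (ℤP.pos-* a b) (Z.+≤+ z≤n)

-- With T ≥ 0 turns, variation V and E low steps, the three estimates
--   k · 2 (m - 2) + T ≤ V,   V + 2 E ≤ 2 m k,   m k ≤ T + (k + 1) E
-- force m ≤ 2 k + 2: the combination (k+1)(first + second) + (k-1) T + 2 (third)
-- of the slacks equals 2 k (2 k + 2 - m).
counting-bound : ∀ m k (E V T : ℤ) → 1 ≤ k → 0ℤ ≤ᶻ T →
                 + k *ᶻ (+ 2 *ᶻ (+ m -ᶻ + 2)) +ᶻ T ≤ᶻ V →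
                 V +ᶻ + 2 *ᶻ E ≤ᶻ + 2 *ᶻ (+ m *ᶻ + k) →
                 + m *ᶻ + k ≤ᶻ T +ᶻ + suc k *ᶻ E →
                 m ≤ 2 * k + 2
counting-bound m (suc κ) E V T _ T≥0 cycles jumps cover =
  ℤP.drop‿+≤+ (ℤP.0≤i-j⇒j≤i (ℤP.*-cancelˡ-≤-pos 0ℤ (K2 +ᶻ + 2 -ᶻ + m) K2 (subst (_≤ᶻ K2 *ᶻ (K2 +ᶻ + 2 -ᶻ + m)) (sym (ℤP.*-zeroʳ K2)) slack)))
  where
  K2 : ℤ
  K2 = + 2 *ᶻ + suc κ
  slack : 0ℤ ≤ᶻ K2 *ᶻ (K2 +ᶻ + 2 -ᶻ + m)
  slack = subst (0ℤ ≤ᶻ_) (combination (+ m) (+ κ) E V T)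
            (ℤP.+-mono-≤ (ℤP.+-mono-≤ (nonneg-* (+ (2 + κ)) (Z.+≤+ z≤n) (ℤP.+-mono-≤ (ℤP.i≤j⇒0≤j-i cycles) (ℤP.i≤j⇒0≤j-i jumps)))
                                      (nonneg-* (+ κ) (Z.+≤+ z≤n) T≥0))
                         (nonneg-* (+ 2) (Z.+≤+ z≤n) (ℤP.i≤j⇒0≤j-i cover)))
    where
    combination : ∀ M X E V T →
        (+ 2 +ᶻ X) *ᶻ ((V -ᶻ ((1ℤ +ᶻ X) *ᶻ (+ 2 *ᶻ (M -ᶻ + 2)) +ᶻ T)) +ᶻ (+ 2 *ᶻ (M *ᶻ (1ℤ +ᶻ X)) -ᶻ (V +ᶻ + 2 *ᶻ E)))
        +ᶻ X *ᶻ T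
        +ᶻ + 2 *ᶻ ((T +ᶻ (+ 2 +ᶻ X) *ᶻ E) -ᶻ M *ᶻ (1ℤ +ᶻ X))
      ≡ (+ 2 *ᶻ (1ℤ +ᶻ X)) *ᶻ (+ 2 *ᶻ (1ℤ +ᶻ X) +ᶻ + 2 -ᶻ M)
    combination = solve-∀

window : ℕ → (ℕ → ℤ) → ℕ → ℤ
window k P i = ∑ k (λ j → P (i + j))

window-step : ∀ k P i → Δ (window k P) i ≡ P (i + k) -ᶻ P i
window-step k P i = exchange (window k P i) (P (i + k)) (P i) (window k P (suc i)) add-entries
  where
  add-entries : window k P i +ᶻ P (i + k) ≡ P i +ᶻ window k P (suc i)
  add-entries = trans (∑-unroll k (λ j → P (i + j)))
                  (cong₂ _+ᶻ_ (cong P (ℕP.+-identityʳ i)) (∑-cong k (λ j → cong P (ℕP.+-suc i j))))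
  exchange : ∀ w p q w' → w +ᶻ p ≡ q +ᶻ w' → w' -ᶻ w ≡ p -ᶻ q
  exchange w p q w' eq = begin
      w' -ᶻ w                ≡⟨ shuffle w q w' ⟩
      (q +ᶻ w') -ᶻ q -ᶻ w    ≡⟨ cong (λ z → z -ᶻ q -ᶻ w) (sym eq) ⟩
      (w +ᶻ p) -ᶻ q -ᶻ w     ≡⟨ unshuffle w p q ⟩
      p -ᶻ q                 ∎
    where
    open ≡-Reasoning
    shuffle : ∀ w q w' → w' -ᶻ w ≡ (q +ᶻ w') -ᶻ q -ᶻ w
    shuffle = solve-∀
    unshuffle : ∀ w p q → (w +ᶻ p) -ᶻ q -ᶻ w ≡ p -ᶻ q
    unshuffle = solve-∀

window-periodic : ∀ {n} k P → Periodic n P → Periodic n (window k P)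
window-periodic {n} k P per i = ∑-cong k (λ j → trans (cong P (swap-end i n j)) (per (i + j)))
  where
  swap-end : ∀ i n j → i + n + j ≡ i + j + n
  swap-end = ℕS.solve-∀

module Windows (m k n A : ℕ) (P : ℕ → ℤ) (n≡mk : n ≡ m * k) (k-odd : Odd k) (m-large : 2 * k + 3 ≤ m)
               (per : Periodic n P) (inj : InjectiveOn n P) (k-apart : ∀ i → P i ≢ P (i + k))
               (average : + n *ᶻ + A ≤ᶻ ∑ n (window k P))
               (close : ∀ i → window k P i ≤ᶻ + A +ᶻ 1ℤ) where

  t : ℕ → ℤ
  t i = window k P i -ᶻ + A

  Δt : ∀ i → Δ t i ≡ P (i + k) -ᶻ P i
  Δt i = trans (cancel (window k P (suc i)) (window k P i) (+ A)) (window-step k P i)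
    where
    cancel : ∀ a b c → (a -ᶻ c) -ᶻ (b -ᶻ c) ≡ a -ᶻ b
    cancel = solve-∀

  t-periodic : Periodic n t
  t-periodic i = cong (_-ᶻ + A) (window-periodic k P per i)

  t≤1 : ∀ i → t i ≤ᶻ 1ℤ
  t≤1 i = subst (t i ≤ᶻ_) (cancel (+ A)) (ℤP.+-monoˡ-≤ (-ᶻ + A) (close i))
    where
    cancel : ∀ a → a +ᶻ 1ℤ -ᶻ a ≡ 1ℤ
    cancel = solve-∀

  t-nonflat : ∀ i → Δ t i ≢ 0ℤ
  t-nonflat i Δ≡0 = k-apart i (sym (ℤP.i-j≡0⇒i≡j _ _ (trans (sym (Δt i)) Δ≡0)))

  ∑t≥0 : 0ℤ ≤ᶻ ∑ n t
  ∑t≥0 = subst (0ℤ ≤ᶻ_) (sym ∑t) (ℤP.i≤j⇒0≤j-i average)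
    where
    ∑t : ∑ n t ≡ ∑ n (window k P) -ᶻ + n *ᶻ + A
    ∑t = trans (∑-+ n (window k P) (λ _ → -ᶻ + A))
           (cong (∑ n (window k P) +ᶻ_) (trans (∑-const n (-ᶻ + A)) (sym (ℤP.neg-distribʳ-* (+ n) (+ A)))))

  open Peaks n t t-periodic t≤1 t-nonflat

  cycle : ℕ → ℕ → ℤ
  cycle r j = P (r + j * k)

  next-in-class : ∀ r j → r + j * k + k ≡ r + suc j * k
  next-in-class r j = shift r j k
    where
    shift : ∀ r j k → r + j * k + k ≡ r + (k + j * k)
    shift = ℕS.solve-∀

  Δ-cycle : ∀ r j → Δ (cycle r) j ≡ Δ t (r + j * k)
  Δ-cycle r j = trans (cong (λ x → P x -ᶻ cycle r j) (sym (next-in-class r j))) (sym (Δt (r + j * k)))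

  cycle-periodic : ∀ r → Periodic m (cycle r)
  cycle-periodic r j = trans (cong P (trans (reindex r j m k) (cong (λ x → r + j * k + x) (sym n≡mk)))) (per (r + j * k))
    where
    reindex : ∀ r j m k → r + (j + m) * k ≡ r + j * k + m * k
    reindex = ℕS.solve-∀

  cycle-nonflat : ∀ r j → Δ (cycle r) j ≢ 0ℤ
  cycle-nonflat r j Δ≡0 = t-nonflat (r + j * k) (trans (sym (Δ-cycle r j)) Δ≡0)

  k≥1 : 1 ≤ k
  k≥1 = subst (1 ≤_) (sym (proj₂ k-odd)) (s≤s z≤n)

  cycle-injective : ∀ r → r < k → InjectiveOn m (cycle r)
  cycle-injective r r<k i j i<m j<m eq =
    ℕP.*-cancelʳ-≡ i j k {{>-nonZero k≥1}}
      (ℕP.+-cancelˡ-≡ r _ _ (inj (r + i * k) (r + j * k) (in-period i i<m) (in-period j j<m) eq))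
    where
    in-period : ∀ i → i < m → r + i * k < n
    in-period i i<m = subst (r + i * k <_) (sym n≡mk)
                        (ℕP.<-≤-trans (ℕP.+-monoˡ-< (i * k) r<k) (ℕP.*-monoˡ-≤ k i<m))

  m≥2 : 2 ≤ m
  m≥2 = ℕP.≤-trans (ℕP.m≤n+m 2 (2 * k + 1)) (ℕP.≤-trans (ℕP.≤-reflexive (ℕP.+-assoc (2 * k) 1 2)) m-large)

  opposite-steps : ℤ
  opposite-steps = ∑ n (λ i → ind (up (Δ t i) xor up (Δ t (i + k))))

  variation-split : variation n t ≡ ∑ k (λ r → variation m (cycle r))
  variation-split = trans (cong (λ x → variation x t) n≡mk)
                      (trans (∑-blocks m k (λ i → abs (Δ t i)))
                             (∑-cong k (λ r → ∑-cong m (λ j → cong abs (sym (Δ-cycle r j))))))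

  turns-split : opposite-steps ≡ ∑ k (λ r → turns m (cycle r))
  turns-split = trans (cong (λ x → ∑ x (λ i → ind (up (Δ t i) xor up (Δ t (i + k))))) n≡mk)
                  (trans (∑-blocks m k (λ i → ind (up (Δ t i) xor up (Δ t (i + k)))))
                         (∑-cong k (λ r → ∑-cong m (λ j → cong₂ (λ d d' → ind (up d xor up d'))
                            (sym (Δ-cycle r j))
                            (trans (cong (Δ t) (next-in-class r j)) (sym (Δ-cycle r (suc j))))))))

  cycles-bound : + k *ᶻ (+ 2 *ᶻ (+ m -ᶻ + 2)) +ᶻ opposite-steps ≤ᶻ variation n t
  cycles-bound = subst₂ _≤ᶻ_ sum-of-bounds (sym variation-split)
    (∑-mono k (λ r r<k → variation-bound m (cycle r) m≥2 (cycle-periodic r) (cycle-nonflat r) (cycle-injective r r<k)))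
    where
    sum-of-bounds : ∑ k (λ r → + 2 *ᶻ (+ m -ᶻ + 2) +ᶻ turns m (cycle r)) ≡ + k *ᶻ (+ 2 *ᶻ (+ m -ᶻ + 2)) +ᶻ opposite-steps
    sum-of-bounds = trans (∑-+ k _ _) (cong₂ _+ᶻ_ (∑-const k _) (sym turns-split))

  contradiction : ⊥
  contradiction = ℕP.<⇒≱ (subst (_≤ m) (ℕP.+-suc (2 * k) 2) m-large)
    (counting-bound m k lows (variation n t) opposite-steps k≥1
       (∑-nonneg n (λ i _ → ind-nonneg (up (Δ t i) xor up (Δ t (i + k)))))
       cycles-bound
       (subst (λ x → variation n t +ᶻ + 2 *ᶻ lows ≤ᶻ + 2 *ᶻ x) n≡m*k (jump-bound ∑t≥0))
       (subst (_≤ᶻ opposite-steps +ᶻ + suc k *ᶻ lows) n≡m*k (turn-cover k k-odd)))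
    where
    n≡m*k : + n ≡ + m *ᶻ + k
    n≡m*k = trans (cong +_ n≡mk) (ℤP.pos-* m k)

gauss : ∀ m → + 2 *ᶻ ∑ m (λ i → + suc i) ≡ + m *ᶻ + suc m
gauss zero    = refl
gauss (suc m) = trans (ℤP.*-distribˡ-+ (+ 2) (∑ m (λ i → + suc i)) (+ suc m))
                  (trans (cong (_+ᶻ + 2 *ᶻ + suc m) (gauss m)) (step (+ m)))
  where
  step : ∀ x → x *ᶻ (1ℤ +ᶻ x) +ᶻ + 2 *ᶻ (1ℤ +ᶻ x) ≡ (1ℤ +ᶻ x) *ᶻ (1ℤ +ᶻ (1ℤ +ᶻ x))
  step = solve-∀

module ℤ+ = MonoidSum ℤP.+-0-commutativeMonoid

∑-Fin : ∀ m (g : ℕ → ℤ) → ∑ m g ≡ ℤ+.sum {m} (λ i → g (toℕ i))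
∑-Fin zero    g = refl
∑-Fin (suc m) g = trans (∑-unroll m g) (cong (g 0 +ᶻ_) (∑-Fin m (g ∘ suc)))

∑-list : ∀ k (g : ℕ → ℕ) → + sum (applyUpTo g k) ≡ ∑ k (λ j → + g j)
∑-list zero    g = refl
∑-list (suc k) g = trans (ℤP.pos-+ (g 0) (sum (applyUpTo (g ∘ suc) k)))
                     (trans (cong (+ g 0 +ᶻ_) (∑-list k (g ∘ suc))) (sym (∑-unroll k (λ j → + g j))))

≤-max : ∀ {m} (f : Fin m → ℕ) i → f i ≤ foldr _⊔_ 0 (tabulate f)
≤-max {suc m} f Fin.zero    = ℕP.m≤m⊔n (f Fin.zero) _
≤-max {suc m} f (Fin.suc i) = ℕP.≤-trans (≤-max (f ∘ Fin.suc) i) (ℕP.m≤n⊔m (f Fin.zero) _)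

module PermutationWindows (N : ℕ) (π : Permutation′ (suc N)) where

  n : ℕ
  n = suc N

  value : ℕ → ℤ
  value x = + suc (toℕ (π ⟨$⟩ʳ (x mod n)))

  toℕ-mod : ∀ x → toℕ (x mod n) ≡ x % n
  toℕ-mod x = FinP.toℕ-fromℕ< _

  mod-cong : ∀ x y → x % n ≡ y % n → x mod n ≡ y mod n
  mod-cong x y eq = FinP.toℕ-injective (trans (toℕ-mod x) (trans eq (sym (toℕ-mod y))))

  value-cong : ∀ x y → x % n ≡ y % n → value x ≡ value y
  value-cong x y eq = cong (λ f → + suc (toℕ (π ⟨$⟩ʳ f))) (mod-cong x y eq)

  value-periodic : Periodic n value
  value-periodic i = value-cong (i + n) i ([m+n]%n≡m%n i n)

  value-mod : ∀ i j → value i ≡ value j → i % n ≡ j % n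
  value-mod i j eq = trans (sym (toℕ-mod i)) (trans (cong toℕ same-mod) (toℕ-mod j))
    where
    same-image : π ⟨$⟩ʳ (i mod n) ≡ π ⟨$⟩ʳ (j mod n)
    same-image = FinP.toℕ-injective (ℕP.suc-injective (ℤP.+-injective eq))
    same-mod : i mod n ≡ j mod n
    same-mod = trans (sym (inverseˡ π)) (trans (cong (π ⟨$⟩ˡ_) same-image) (inverseˡ π))

  value-injective : InjectiveOn n value
  value-injective i j i<n j<n eq = trans (sym (m<n⇒m%n≡m i<n)) (trans (value-mod i j eq) (m<n⇒m%n≡m j<n))

  -- Entries at distance 0 < k < n differ, since otherwise n would divide k.
  value-apart : ∀ k → 0 < k → k < n → ∀ i → value i ≢ value (i + k)
  value-apart k 0<k k<n i eq = ℕP.<⇒≱ k<n (∣⇒≤ {{>-nonZero 0<k}} n∣k)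
    where
    r = i % n
    quotient-shift : (i div n) * n + k ≡ ((i + k) div n) * n
    quotient-shift = ℕP.+-cancelˡ-≡ r _ _
      (trans (sym (ℕP.+-assoc r _ k)) (trans (cong (_+ k) (sym (m≡m%n+[m/n]*n i n)))
        (trans (m≡m%n+[m/n]*n (i + k) n) (cong (_+ ((i + k) div n) * n) (sym (value-mod i (i + k) eq))))))
    n∣k = ∣m+n∣m⇒∣n (divides ((i + k) div n) quotient-shift) (n∣m*n (i div n))

  value-total : ∑ n value ≡ ∑ n (λ i → + suc i)
  value-total = begin
      ∑ n value                         ≡⟨ ∑-Fin n value ⟩
      ℤ+.sum {n} (λ i → value (toℕ i))  ≡⟨ ℤ+.sum-cong-≗ {n} (λ i → cong (λ f → + suc (toℕ (π ⟨$⟩ʳ f))) (mod-toℕ i)) ⟩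
      ℤ+.sum {n} (label ∘ (π ⟨$⟩ʳ_))    ≡⟨ sym (ℤ+.sum-permute label π) ⟩
      ℤ+.sum {n} label                  ≡⟨ sym (∑-Fin n (λ i → + suc i)) ⟩
      ∑ n (λ i → + suc i)               ∎
    where
    open ≡-Reasoning
    label : Fin n → ℤ
    label j = + suc (toℕ j)
    mod-toℕ : ∀ (i : Fin n) → toℕ i mod n ≡ i
    mod-toℕ i = FinP.toℕ-injective (trans (toℕ-mod (toℕ i)) (m<n⇒m%n≡m (FinP.toℕ<n i)))

  windowSum≡window : ∀ k i → + windowSum π k (i mod n) ≡ window k value i
  windowSum≡window k i =
    trans (cong (λ l → + sum l) (ListP.map-upTo (λ j → suc (toℕ (π ⟨$⟩ʳ ((toℕ (i mod n) + j) mod n)))) k))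
      (trans (∑-list k (λ j → suc (toℕ (π ⟨$⟩ʳ ((toℕ (i mod n) + j) mod n)))))
             (∑-cong k (λ j → value-cong (toℕ (i mod n) + j) (i + j) (same-residue j))))
    where
    same-residue : ∀ j → (toℕ (i mod n) + j) % n ≡ (i + j) % n
    same-residue j = sym (trans (cong (_% n) (trans (cong (_+ j) (m≡m%n+[m/n]*n i n)) (swap (i % n) ((i div n) * n) j)))
                       (trans ([m+kn]%n≡m%n (i % n + j) (i div n) n) (cong (λ z → (z + j) % n) (sym (toℕ-mod i)))))
      where
      swap : ∀ a b c → a + b + c ≡ a + c + b
      swap = ℕS.solve-∀

  window≤max : ∀ k i → window k value i ≤ᶻ + maxWindowSum π k
  window≤max k i = subst (_≤ᶻ + maxWindowSum π k) (windowSum≡window k i)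
    (Z.+≤+ (subst (windowSum π k (i mod n) ≤_) (cong (foldr _⊔_ 0) (sym (ListP.map-tabulate (λ x → x) (windowSum π k))))
                  (≤-max (windowSum π k) (i mod n))))

  value-sum : ∀ H → suc n ≡ 2 * H → ∑ n value ≡ + n *ᶻ + H
  value-sum H n+1≡2H = ℤP.*-cancelˡ-≡ (+ 2) (∑ n value) (+ n *ᶻ + H)
    (trans (cong (+ 2 *ᶻ_) value-total) (trans (gauss n)
      (trans (cong (λ z → + n *ᶻ + z) n+1≡2H) (trans (cong (+ n *ᶻ_) (ℤP.pos-* 2 H)) (reorder (+ n) (+ H))))))
    where
    reorder : ∀ a b → a *ᶻ (+ 2 *ᶻ b) ≡ + 2 *ᶻ (a *ᶻ b)
    reorder = solve-∀

  window-total : ∀ k H → suc n ≡ 2 * H → ∑ n (window k value) ≡ + n *ᶻ + (k * H)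
  window-total k H n+1≡2H = begin
      ∑ n (window k value)
    ≡⟨ ∑-swap n k (λ i j → value (i + j)) ⟩
      ∑ k (λ j → ∑ n (λ i → value (i + j)))
    ≡⟨ ∑-cong k (λ j → trans (∑-cong n (λ i → cong value (ℕP.+-comm i j))) (∑-rotate n value value-periodic j)) ⟩
      ∑ k (λ _ → ∑ n value)
    ≡⟨ trans (∑-const k (∑ n value)) (cong (+ k *ᶻ_) (value-sum H n+1≡2H)) ⟩
      + k *ᶻ (+ n *ᶻ + H)
    ≡⟨ trans (reorder (+ k) (+ n) (+ H)) (cong (+ n *ᶻ_) (sym (ℤP.pos-* k H))) ⟩
      + n *ᶻ + (k * H)
    ∎
    where
    open ≡-Reasoning
    reorder : ∀ a b c → a *ᶻ (b *ᶻ c) ≡ b *ᶻ (a *ᶻ c)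
    reorder = solve-∀

  max-window-large : ∀ m k H → n ≡ m * k → Odd k → 2 * k + 3 ≤ m → suc n ≡ 2 * H →
                     k * H + 2 ≤ maxWindowSum π k
  max-window-large m k H n≡mk k-odd m-large n+1≡2H with k * H + 2 ≤? maxWindowSum π k
  ... | yes large = large
  ... | no small  = ⊥-elim (Windows.contradiction m k n (k * H) value n≡mk k-odd m-large
                              value-periodic value-injective (value-apart k 0<k k<n)
                              (ℤP.≤-reflexive (sym (window-total k H n+1≡2H))) close)
    where
    0<k : 0 < k
    0<k = subst (0 <_) (sym (proj₂ k-odd)) (s≤s z≤n)
    k<n : k < n
    k<n = subst (k <_) (sym n≡mk) (ℕP.<-≤-trans (ℕP.m<m+n k 0<k)
            (subst (_≤ m * k) (cong (λ x → k + x) (ℕP.+-identityʳ k)) (ℕP.*-monoˡ-≤ k 2≤m)))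
      where
      2≤m : 2 ≤ m
      2≤m = ℕP.≤-trans (ℕP.m≤n+m 2 (2 * k + 1)) (ℕP.≤-trans (ℕP.≤-reflexive (ℕP.+-assoc (2 * k) 1 2)) m-large)
    close : ∀ i → window k value i ≤ᶻ + (k * H) +ᶻ 1ℤ
    close i = subst (window k value i ≤ᶻ_) (ℤP.pos-+ (k * H) 1)
                (ℤP.≤-trans (window≤max k i) (Z.+≤+ (s≤s⁻¹ (subst (maxWindowSum π k <_) (ℕP.+-suc (k * H) 1) (ℕP.≰⇒> small)))))

msum-≥-2 : ∀ M A → A + 2 ≤ M → ((+ 2) / 1) ≤ℚ ((+ M) / 1) -ℚ ((+ (2 * A)) / 2)
msum-≥-2 M A A+2≤M = ℚP.toℚᵘ-cancel-≤ (ℚᵘP.≤-respʳ-≃ (ℚᵘP.≃-sym as-fraction) cross-multiplied)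
  where
  as-fraction : toℚᵘ (((+ M) / 1) -ℚ ((+ (2 * A)) / 2)) ℚᵘ.≃ mkℚᵘ (+ M) 0 ℚᵘ.+ (ℚᵘ.- mkℚᵘ (+ (2 * A)) 1)
  as-fraction = ℚᵘP.≃-trans (ℚP.toℚᵘ-homo-+ ((+ M) / 1) (-ℚ ((+ (2 * A)) / 2)))
    (ℚᵘP.+-cong (ℚP.toℚᵘ-fromℚᵘ (mkℚᵘ (+ M) 0))
                (ℚᵘP.≃-trans (ℚP.toℚᵘ-homo‿- ((+ (2 * A)) / 2)) (ℚᵘP.-‿cong (ℚP.toℚᵘ-fromℚᵘ (mkℚᵘ (+ (2 * A)) 1)))))
  room : 0ℤ ≤ᶻ + M -ᶻ + A -ᶻ + 2
  room = subst (0ℤ ≤ᶻ_) (regroup (+ M) (+ A)) (ℤP.i≤j⇒0≤j-i (Z.+≤+ A+2≤M))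
    where
    regroup : ∀ M A → M -ᶻ (A +ᶻ + 2) ≡ M -ᶻ A -ᶻ + 2
    regroup = solve-∀
  cross-multiplied : toℚᵘ ((+ 2) / 1) ℚᵘ.≤ mkℚᵘ (+ M) 0 ℚᵘ.+ (ℚᵘ.- mkℚᵘ (+ (2 * A)) 1)
  cross-multiplied = *≤* (≤-by-difference _ _ _
    (trans (clear (+ M) (+ (2 * A))) (trans (cong (λ B → + M +ᶻ + M -ᶻ B -ᶻ + 4) (ℤP.pos-* 2 A)) (twice (+ M) (+ A))))
    (ℤP.+-mono-≤ room room))
    where
    clear : ∀ M B → (M *ᶻ + 2 +ᶻ -ᶻ B *ᶻ + 1) *ᶻ + 1 -ᶻ + 2 *ᶻ + 2 ≡ M +ᶻ M -ᶻ B -ᶻ + 4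
    clear = solve-∀
    twice : ∀ M A → M +ᶻ M -ᶻ + 2 *ᶻ A -ᶻ + 4 ≡ (M -ᶻ A -ᶻ + 2) +ᶻ (M -ᶻ A -ᶻ + 2)
    twice = solve-∀

-- Lemma 5.3: for odd m, k with k ≥ 3 and m ≥ 2 k + 3, msum(m k, k) ≥ 2.
-- With m = 1 + 2 a, k = 1 + 2 b the average window sum is k H for
-- n + 1 = 2 H, H = 1 + a + b + 2 a b, and some window reaches k H + 2.
lemma5p3 : (m k : ℕ) → Odd m → Odd k → 3 ≤ k → 2 * k + 3 ≤ m →
    (π : Permutation′ (m * k)) → ((+ 2) / 1) ≤ℚ msumπ π k
lemma5p3 m k (a , refl) k-odd@(b , refl) _ m-large π =
  subst (λ z → ((+ 2) / 1) ≤ℚ ((+ maxWindowSum π (1 + 2 * b)) / 1) -ℚ ((+ z) / 2)) (sym (average-twice a b))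
    (msum-≥-2 (maxWindowSum π (1 + 2 * b)) ((1 + 2 * b) * H)
      (PermutationWindows.max-window-large (2 * b + 2 * a * (1 + 2 * b)) π
         (1 + 2 * a) (1 + 2 * b) H refl k-odd m-large (n+1≡2H a b)))
  where
  H : ℕ
  H = 1 + a + b + 2 * a * b
  n+1≡2H : ∀ a b → 2 + (2 * b + 2 * a * (1 + 2 * b)) ≡ 2 * (1 + a + b + 2 * a * b)
  n+1≡2H = ℕS.solve-∀
  average-twice : ∀ a b → (1 + 2 * b) * ((1 + 2 * a) * (1 + 2 * b) + 1) ≡ 2 * ((1 + 2 * b) * (1 + a + b + 2 * a * b))
  average-twice = ℕS.solve-∀
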